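{- Let $G=(V,E)$ be a graph, $k\ge 1$ an integer, and let $v\in V$ satisfy $|N(v)|>7k$ and $\rho(v)> \frac{|N(v)|(|N(v)|-1)}{4}$. Then for every feasible solution $X$ with $v\notin X$, the vertex $v$ lies in a connected component of $G-X$ that is a clique.
   Context: Graphs are undirected, without self-loops, possibly with multi-edges. $N(v)$ is the set of neighbors of $v$; $\rho(v)$ is the number of unordered pairs $\{u_1,u_2\}\subseteq N(v)$ with $u_1u_2\in E$ (parallel edges counted once). A set induces a clique if there is exactly one edge between any two distinct vertices; it induces a tree if connected with no cycle (parallel edges form a cycle). A feasible solution for $(G,k)$ is a set $X\subseteq V$ with $|X|\le k$ such that every connected component of $G-X$ is a clique or a tree. -}

module Defs where

open import Data.Nat using (ℕ; zero; suc; _≤_; _<_)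
open import Data.Fin using (Fin; zero; suc; inject₁; fromℕ) renaming (_<_ to _<ᶠ_; _<?_ to _<ᶠ?_)
open import Data.Fin.Properties using (_≟_; any?)
open import Data.Fin.Subset using (Subset; _∈_; _∉_)
open import Data.Product using (Σ; ∃; _×_; _,_; proj₁; proj₂)
open import Data.Product.Properties using (≡-dec)
open import Data.Product.Relation.Unary.All using ()
open import Data.Sum using (_⊎_; inj₁; inj₂)
open import Data.List using (List; length; filter; allFin; cartesianProduct)
open import Relation.Nullary using (¬_; Dec)
open import Relation.Nullary.Decidable using (_⊎-dec_; _×-dec_)
open import Relation.Unary using (Pred; Decidable)
open import Relation.Binary.PropositionalEquality using (_≡_; _≢_)
open import Function.Definitions using (Injective)
open import Level using (0ℓ)

-- A finite undirected multigraph without self-loops: vertices Fin n,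
-- edges Fin m (edges have identities, so parallel edges are allowed);
-- edge e has end vertices ends e, which are distinct.
record Graph : Set where
  field
    n        : ℕ
    m        : ℕ
    ends     : Fin m → Fin n × Fin n
    loopless : ∀ e → proj₁ (ends e) ≢ proj₂ (ends e)

module _ (G : Graph) where
  open Graph G

  V : Set
  V = Fin n

  Joins : Fin m → V → V → Set
  Joins e a b = ends e ≡ (a , b) ⊎ ends e ≡ (b , a)

  joins? : ∀ e a b → Dec (Joins e a b)
  joins? e a b = ≡-dec _≟_ _≟_ (ends e) (a , b) ⊎-dec ≡-dec _≟_ _≟_ (ends e) (b , a)

  Adj : V → V → Set
  Adj a b = ∃ λ e → Joins e a b

  adj? : ∀ a b → Dec (Adj a b)
  adj? a b = any? (λ e → joins? e a b)

  countV : {P : Pred V 0ℓ} → Decidable P → ℕ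
  countV P? = length (filter P? (allFin n))

  degN : V → ℕ
  degN v = countV (adj? v)

  -- ρ(v): number of unordered pairs {u₁,u₂} ⊆ N(v) (u₁ ≠ u₂, counted as u₁ < u₂)
  -- with u₁u₂ ∈ E (parallel edges counted once)
  RhoPair : V → Pred (V × V) 0ℓ
  RhoPair v (u₁ , u₂) = (u₁ <ᶠ u₂) × (Adj v u₁ × (Adj v u₂ × Adj u₁ u₂))

  rhoPair? : ∀ v → Decidable (RhoPair v)
  rhoPair? v (u₁ , u₂) = (u₁ <ᶠ? u₂) ×-dec (adj? v u₁ ×-dec (adj? v u₂ ×-dec adj? u₁ u₂))

  ρ : V → ℕ
  ρ v = length (filter (rhoPair? v) (cartesianProduct (allFin n) (allFin n)))

  -- reachability from a to b by a path all of whose vertices satisfy S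
  -- (i.e. a path in the induced subgraph G[S])
  data ReachIn (S : Pred V 0ℓ) (a : V) : V → Set where
    here : S a → ReachIn S a a
    step : ∀ {b c} e → ReachIn S a b → Joins e b c → S c → ReachIn S a c

  -- a cycle in G[S]: closed walk vs 0, …, vs L = vs 0 of length L ≥ 2 with
  -- pairwise distinct vertices vs 0 … vs (L-1) and pairwise distinct edges
  -- (so two parallel edges form a cycle of length 2)
  record Cycle (S : Pred V 0ℓ) : Set where
    field
      L      : ℕ
      L≥2    : 2 ≤ L
      vs     : Fin (suc L) → V
      es     : Fin L → Fin m
      closed : vs (fromℕ L) ≡ vs zero
      inS    : ∀ i → S (vs i)
      edge   : ∀ i → Joins (es i) (vs (inject₁ i)) (vs (suc i))
      vinj   : Injective _≡_ _≡_ (λ i → vs (inject₁ i))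
      einj   : Injective _≡_ _≡_ es

  -- S induces a clique: exactly one edge between any two distinct vertices
  IsClique : Pred V 0ℓ → Set
  IsClique S = ∀ a b → S a → S b → a ≢ b →
    Σ (Fin m) λ e → Joins e a b × (∀ e' → Joins e' a b → e' ≡ e)

  IsTree : Pred V 0ℓ → Set
  IsTree S = (∀ a b → S a → S b → ReachIn S a b) × ¬ Cycle S

  Outside : Subset n → Pred V 0ℓ
  Outside X w = w ∉ X

  Component : Subset n → V → Pred V 0ℓ
  Component X u = ReachIn (Outside X) u

  Feasible : ℕ → Subset n → Set
  Feasible k X = Data.Fin.Subset.∣ X ∣ ≤ k ×
    (∀ u → u ∉ X → IsClique (Component X u) ⊎ IsTree (Component X u))

{-# OPTIONS --safe #-}
-- If the component of v in G - X were a tree, no edge u₁u₂ inside N(v) could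
-- survive in G - X, since v u₁ u₂ would be a triangle in that component.  So
-- every pair counted by ρ(v) meets X; orienting each such pair with an endpoint
-- in X first maps these pairs injectively into X × N(v), whence
-- ρ(v) ≤ |X| |N(v)| ≤ k |N(v)|.  Since |N(v)| - 1 ≥ 4k this contradicts
-- 4 ρ(v) > |N(v)| (|N(v)| - 1).
module Submission where

open import Defs
open import Data.Nat using (ℕ; zero; suc; _+_; _*_; _∸_; _≤_; _<_; z≤n; s≤s)
open import Data.Nat.Properties
  using (*-comm; *-assoc; *-monoʳ-≤; *-monoˡ-≤; m≤m+n; <⇒≱; ≰⇒>; ≤-<-trans; module ≤-Reasoning)
open import Data.Fin using (Fin; zero; suc; inject₁) renaming (_<_ to _<ᶠ_)
import Data.Fin.Properties as Fin
open import Data.Fin.Subset using (Subset; _∈_; _∉_; inside; outside; ∣_∣)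
open import Data.Fin.Subset.Properties using (_∈?_)
import Data.Vec.Base as Vec
open import Data.Product using (_×_; _,_; proj₁; proj₂; swap)
open import Data.Product.Properties using (≡-dec)
open import Data.Sum using (_⊎_; inj₁; inj₂)
open import Data.Empty using (⊥-elim)
open import Data.List using (List; []; _∷_; length; filter; allFin; cartesianProduct; map; _++_)
open import Data.List.Properties using (length-map; length-++; filter-notAll)
open import Data.List.Relation.Unary.Any using (here; there)
import Data.List.Relation.Unary.Any as Any
import Data.List.Relation.Unary.All as All
open import Data.List.Relation.Unary.AllPairs using (_∷_)
open import Data.List.Relation.Unary.Unique.Propositional using (Unique)
import Data.List.Relation.Unary.Unique.Propositional.Properties as Unique
open import Data.List.Membership.Propositional using () renaming (_∈_ to _∈ₗ_)
open import Data.List.Membership.Propositional.Properties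
  using (∈-filter⁺; ∈-filter⁻; ∈-allFin; ∈-cartesianProduct⁺; ∈-map⁺)
open import Relation.Nullary using (¬_; yes; no; ¬?)
open import Relation.Binary.Definitions using (DecidableEquality)
open import Relation.Binary.PropositionalEquality using (_≡_; _≢_; ≢-sym; refl; sym; trans; cong; cong₂; module ≡-Reasoning)
open import Function using (_∘_)
open import Function.Definitions using (Injective)

length-cartesianProduct : ∀ {A B : Set} (xs : List A) (ys : List B) →
  length (cartesianProduct xs ys) ≡ length xs * length ys
length-cartesianProduct []       ys = refl
length-cartesianProduct (x ∷ xs) ys = begin
  length (map (x ,_) ys ++ cartesianProduct xs ys)         ≡⟨ length-++ (map (x ,_) ys) ⟩
  length (map (x ,_) ys) + length (cartesianProduct xs ys) ≡⟨ cong₂ _+_ (length-map (x ,_) ys) (length-cartesianProduct xs ys) ⟩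
  length ys + length xs * length ys                        ∎
  where open ≡-Reasoning

module _ {A B : Set} (_≟_ : DecidableEquality B) where

  injectiveOn⇒length≤ : ∀ {f : A → B} {xs ys} → Unique xs →
    (∀ {x} → x ∈ₗ xs → f x ∈ₗ ys) →
    (∀ {x y} → x ∈ₗ xs → y ∈ₗ xs → f x ≡ f y → x ≡ y) →
    length xs ≤ length ys
  injectiveOn⇒length≤ {xs = []} _ _ _ = z≤n
  injectiveOn⇒length≤ {f} {x ∷ xs} {ys} (x∉xs ∷ xs!) maps inj = begin
    suc (length xs)    ≤⟨ s≤s (injectiveOn⇒length≤ xs! maps′ (λ x∈ y∈ → inj (there x∈) (there y∈))) ⟩
    suc (length ys-fx)    ≤⟨ filter-notAll (λ z → ¬? (f x ≟ z)) ys (Any.map (λ fx≡z fx≢z → fx≢z fx≡z) (maps (here refl))) ⟩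
    length ys          ∎
    where
    open ≤-Reasoning
    ys-fx : List B
    ys-fx = filter (λ z → ¬? (f x ≟ z)) ys
    maps′ : ∀ {y} → y ∈ₗ xs → f y ∈ₗ ys-fx
    maps′ y∈ = ∈-filter⁺ _ (maps (there y∈)) (λ fx≡fy → All.lookup x∉xs y∈ (inj (here refl) (there y∈) fx≡fy))

elements : ∀ {n} → Subset n → List (Fin n)
elements {zero}  Vec.[]            = []
elements {suc n} (inside  Vec.∷ X) = zero ∷ map suc (elements X)
elements {suc n} (outside Vec.∷ X) = map suc (elements X)

length-elements : ∀ {n} (X : Subset n) → length (elements X) ≡ ∣ X ∣
length-elements Vec.[]            = refl
length-elements (inside  Vec.∷ X) = cong suc (trans (length-map suc (elements X)) (length-elements X))
length-elements (outside Vec.∷ X) = trans (length-map suc (elements X)) (length-elements X)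

∈-elements : ∀ {n} {x : Fin n} {X : Subset n} → x ∈ X → x ∈ₗ elements X
∈-elements {x = zero}  {inside  Vec.∷ X} Vec.here      = here refl
∈-elements {x = suc x} {inside  Vec.∷ X} (Vec.there p) = there (∈-map⁺ suc (∈-elements p))
∈-elements {x = suc x} {outside Vec.∷ X} (Vec.there p) = ∈-map⁺ suc (∈-elements p)

injective₃ : ∀ {A : Set} {f : Fin 3 → A} →
  f zero ≢ f (suc zero) → f (suc zero) ≢ f (suc (suc zero)) → f (suc (suc zero)) ≢ f zero →
  Injective _≡_ _≡_ f
injective₃ _  _  _  {zero}           {zero}           _  = refl
injective₃ ab _  _  {zero}           {suc zero}       eq = ⊥-elim (ab eq)
injective₃ _  _  ca {zero}           {suc (suc zero)} eq = ⊥-elim (ca (sym eq))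
injective₃ ab _  _  {suc zero}       {zero}           eq = ⊥-elim (ab (sym eq))
injective₃ _  _  _  {suc zero}       {suc zero}       _  = refl
injective₃ _  bc _  {suc zero}       {suc (suc zero)} eq = ⊥-elim (bc eq)
injective₃ _  _  ca {suc (suc zero)} {zero}           eq = ⊥-elim (ca eq)
injective₃ _  bc _  {suc (suc zero)} {suc zero}       eq = ⊥-elim (bc (sym eq))
injective₃ _  _  _  {suc (suc zero)} {suc (suc zero)} _  = refl

4k<d⇒d[d∸1]<4r⇒kd<r : ∀ {d k r} → 4 * k < d → d * (d ∸ 1) < 4 * r → k * d < r
4k<d⇒d[d∸1]<4r⇒kd<r {suc d} {k} {r} (s≤s 4k≤d) d[d∸1]<4r = ≰⇒> λ r≤kd → <⇒≱ d[d∸1]<4r (begin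
  4 * r           ≤⟨ *-monoʳ-≤ 4 r≤kd ⟩
  4 * (k * suc d) ≡⟨ sym (*-assoc 4 k (suc d)) ⟩
  4 * k * suc d   ≡⟨ *-comm (4 * k) (suc d) ⟩
  suc d * (4 * k) ≤⟨ *-monoʳ-≤ (suc d) 4k≤d ⟩
  suc d * d       ∎)
  where open ≤-Reasoning

module _ (G : Graph) where
  open Graph G

  Joins-sym : ∀ {e a b} → Joins G e a b → Joins G e b a
  Joins-sym (inj₁ eq) = inj₂ eq
  Joins-sym (inj₂ eq) = inj₁ eq

  Joins-injʳ : ∀ {e a b c} → Joins G e a b → Joins G e a c → b ≡ c
  Joins-injʳ (inj₁ p) (inj₁ q) = cong proj₂ (trans (sym p) q)
  Joins-injʳ (inj₁ p) (inj₂ q) = trans (cong proj₂ (trans (sym p) q)) (cong proj₁ (trans (sym p) q))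
  Joins-injʳ (inj₂ p) (inj₁ q) = trans (cong proj₁ (trans (sym p) q)) (cong proj₂ (trans (sym p) q))
  Joins-injʳ (inj₂ p) (inj₂ q) = cong proj₁ (trans (sym p) q)

  Joins⇒edge≢ : ∀ {e e′ a b c} → Joins G e a b → Joins G e′ a c → b ≢ c → e ≢ e′
  Joins⇒edge≢ j j′ b≢c refl = b≢c (Joins-injʳ j j′)

  Adj-sym : ∀ {a b} → Adj G a b → Adj G b a
  Adj-sym (e , j) = e , Joins-sym j

  Adj⇒≢ : ∀ {a b} → Adj G a b → a ≢ b
  Adj⇒≢ (e , inj₁ eq) refl = loopless e (trans (cong proj₁ eq) (sym (cong proj₂ eq)))
  Adj⇒≢ (e , inj₂ eq) refl = loopless e (trans (cong proj₁ eq) (sym (cong proj₂ eq)))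

  record Triangle (S : V G → Set) : Set where
    field
      a b c : V G
      a∈S   : S a
      b∈S   : S b
      c∈S   : S c
      a-b   : Adj G a b
      b-c   : Adj G b c
      c-a   : Adj G c a

  Triangle⇒Cycle : ∀ {S} → Triangle S → Cycle G S
  Triangle⇒Cycle {S} t = record
    { L      = 3
    ; L≥2    = s≤s (s≤s z≤n)
    ; vs     = vs
    ; es     = es
    ; closed = refl
    ; inS    = inS
    ; edge   = edge
    ; vinj   = injective₃ (Adj⇒≢ a-b) (Adj⇒≢ b-c) (Adj⇒≢ c-a)
    ; einj   = injective₃ (Joins⇒edge≢ (Joins-sym (proj₂ a-b)) (proj₂ b-c) (≢-sym (Adj⇒≢ c-a)))
                          (Joins⇒edge≢ (Joins-sym (proj₂ b-c)) (proj₂ c-a) (≢-sym (Adj⇒≢ a-b)))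
                          (Joins⇒edge≢ (Joins-sym (proj₂ c-a)) (proj₂ a-b) (≢-sym (Adj⇒≢ b-c)))
    }
    where
    open Triangle t
    vs : Fin 4 → V G
    vs zero                   = a
    vs (suc zero)             = b
    vs (suc (suc zero))       = c
    vs (suc (suc (suc zero))) = a
    es : Fin 3 → Fin m
    es zero             = proj₁ a-b
    es (suc zero)       = proj₁ b-c
    es (suc (suc zero)) = proj₁ c-a
    inS : ∀ i → S (vs i)
    inS zero                   = a∈S
    inS (suc zero)             = b∈S
    inS (suc (suc zero))       = c∈S
    inS (suc (suc (suc zero))) = a∈S
    edge : ∀ i → Joins G (es i) (vs (inject₁ i)) (vs (suc i))
    edge zero             = proj₂ a-b
    edge (suc zero)       = proj₂ b-c
    edge (suc (suc zero)) = proj₂ c-a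

  acyclic⇒ρ-pairs-meet : ∀ {X v u₁ u₂} → v ∉ X → ¬ Cycle G (Component G X v) →
    RhoPair G v (u₁ , u₂) → u₁ ∈ X ⊎ u₂ ∈ X
  acyclic⇒ρ-pairs-meet {X} {v} {u₁} {u₂} v∉X acyclic (_ , v-u₁ , v-u₂ , u₁-u₂) with u₁ ∈? X | u₂ ∈? X
  ... | yes u₁∈X | _        = inj₁ u₁∈X
  ... | no _     | yes u₂∈X = inj₂ u₂∈X
  ... | no u₁∉X  | no u₂∉X  = ⊥-elim (acyclic (Triangle⇒Cycle record
    { a∈S = here v∉X
    ; b∈S = step (proj₁ v-u₁) (here v∉X) (proj₂ v-u₁) u₁∉X
    ; c∈S = step (proj₁ v-u₂) (here v∉X) (proj₂ v-u₂) u₂∉X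
    ; a-b = v-u₁
    ; b-c = u₁-u₂
    ; c-a = Adj-sym v-u₂
    }))

  module _ (v : V G) (X : Subset n) where

    ρ-pairs : List (V G × V G)
    ρ-pairs = filter (rhoPair? G v) (cartesianProduct (allFin n) (allFin n))

    neighbours : List (V G)
    neighbours = filter (adj? G v) (allFin n)

    orient : V G × V G → V G × V G
    orient (a , b) with a ∈? X
    ... | yes _ = a , b
    ... | no _  = b , a

    orient-injective : ∀ {a b c d} → a <ᶠ b → c <ᶠ d → orient (a , b) ≡ orient (c , d) → (a , b) ≡ (c , d)
    orient-injective {a} {b} {c} {d} a<b c<d with a ∈? X | c ∈? X
    ... | yes _ | yes _ = λ eq → eq
    ... | no _  | no _  = cong swap
    ... | yes _ | no _  = λ { refl → ⊥-elim (Fin.<-asym a<b c<d) }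
    ... | no _  | yes _ = λ { refl → ⊥-elim (Fin.<-asym a<b c<d) }

    orient-∈ : ∀ {a b} → RhoPair G v (a , b) → a ∈ X ⊎ b ∈ X →
      orient (a , b) ∈ₗ cartesianProduct (elements X) neighbours
    orient-∈ {a} {b} (_ , v-a , v-b , _) a∈X⊎b∈X with a ∈? X | a∈X⊎b∈X
    ... | yes a∈X | _        = ∈-cartesianProduct⁺ (∈-elements a∈X) (∈-filter⁺ (adj? G v) (∈-allFin b) v-b)
    ... | no a∉X  | inj₁ a∈X = ⊥-elim (a∉X a∈X)
    ... | no _    | inj₂ b∈X = ∈-cartesianProduct⁺ (∈-elements b∈X) (∈-filter⁺ (adj? G v) (∈-allFin a) v-a)

    ρ≤∣X∣*degN : (∀ {u₁ u₂} → RhoPair G v (u₁ , u₂) → u₁ ∈ X ⊎ u₂ ∈ X) → ρ G v ≤ ∣ X ∣ * degN G v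
    ρ≤∣X∣*degN meets = begin
      length ρ-pairs                                   ≤⟨ injectiveOn⇒length≤ (≡-dec Fin._≟_ Fin._≟_) unique maps injective ⟩
      length (cartesianProduct (elements X) neighbours) ≡⟨ length-cartesianProduct (elements X) neighbours ⟩
      length (elements X) * degN G v                   ≡⟨ cong (_* degN G v) (length-elements X) ⟩
      ∣ X ∣ * degN G v                                 ∎
      where
      open ≤-Reasoning
      counted : ∀ {p} → p ∈ₗ ρ-pairs → RhoPair G v p
      counted = proj₂ ∘ ∈-filter⁻ (rhoPair? G v) {xs = cartesianProduct (allFin n) (allFin n)}
      unique : Unique ρ-pairs
      unique = Unique.filter⁺ (rhoPair? G v) (Unique.cartesianProduct⁺ (Unique.allFin⁺ n) (Unique.allFin⁺ n))
      maps : ∀ {p} → p ∈ₗ ρ-pairs → orient p ∈ₗ cartesianProduct (elements X) neighbours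
      maps p∈ = orient-∈ (counted p∈) (meets (counted p∈))
      injective : ∀ {p q} → p ∈ₗ ρ-pairs → q ∈ₗ ρ-pairs → orient p ≡ orient q → p ≡ q
      injective p∈ q∈ = orient-injective (proj₁ (counted p∈)) (proj₁ (counted q∈))

lemma6 : (G : Graph) (k : ℕ) → 1 ≤ k → (v : V G) →
    7 * k < degN G v →
    degN G v * (degN G v ∸ 1) < 4 * ρ G v →
    (X : Subset (Graph.n G)) → Feasible G k X → v ∉ X →
    IsClique G (Component G X v)
lemma6 G k _ v 7k<d dense X (∣X∣≤k , feasible) v∉X with feasible v v∉X
... | inj₁ clique       = clique
... | inj₂ (_ , acyclic) = ⊥-elim (<⇒≱ (4k<d⇒d[d∸1]<4r⇒kd<r {k = k} 4k<d dense) (begin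
  ρ G v            ≤⟨ ρ≤∣X∣*degN G v X (acyclic⇒ρ-pairs-meet G v∉X acyclic) ⟩
  ∣ X ∣ * degN G v ≤⟨ *-monoˡ-≤ (degN G v) ∣X∣≤k ⟩
  k * degN G v     ∎))
  where
  open ≤-Reasoning
  4k<d : 4 * k < degN G v
  4k<d = ≤-<-trans (*-monoˡ-≤ k (m≤m+n 4 3)) 7k<d
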